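{- Let $G$ be a graph, let $\overline G$ be the graph obtained from $G$ by contracting every bridge, and let $\rho:G\to\overline G$ be the natural surjective morphism. Then for every divisor $D$ on $G$, $D\sim_G0$ if and only if $\rho_*(D)\sim_{\overline G}0$.
   Context: A graph is a finite, connected multigraph without loop edges. A bridge is an edge whose deletion disconnects the graph. Contracting a bridge $e=x_1x_2$ identifies $x_1$ and $x_2$ into a single vertex and deletes $e$; $\rho$ sends each vertex of $G$ to its image vertex. Divisors are elements of the free abelian group on the vertex set. For $f:V(G)\to\mathbb{Z}$, $\mathrm{div}(f)=\sum_x\sum_{e=xy}(f(x)-f(y))(x)$. $D\sim_G0$ means $D=\mathrm{div}(f)$ for some $f$, and $\rho_*(D)=\sum_x D(x)(\rho(x))$. -}

module Defs where

open import Data.Nat using (ℕ; zero; suc)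
open import Data.Fin using (Fin; zero; suc)
open import Data.Fin.Properties using (_≟_)
open import Data.Integer using (ℤ; _+_; _-_; 0ℤ)
open import Data.Product using (_×_; _,_; proj₁; proj₂; Σ; ∃; ∃-syntax)
open import Data.Unit using (⊤)
open import Relation.Nullary using (¬_; yes; no)
open import Relation.Binary.PropositionalEquality using (_≡_; _≢_)
open import Function.Bundles using (_⇔_)

-- A finite multigraph: vertices Fin n, edges Fin m, each edge with its
-- two endpoints (an arbitrary orientation, irrelevant for everything below).
record Graph : Set where
  field
    n : ℕ
    m : ℕ
    ends : Fin m → Fin n × Fin n

open Graph public

src tgt : (G : Graph) → Fin (m G) → Fin (n G)
src G e = proj₁ (ends G e)
tgt G e = proj₂ (ends G e)

Loopless : Graph → Set
Loopless G = ∀ e → src G e ≢ tgt G e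

data Reach (G : Graph) (P : Fin (m G) → Set) : Fin (n G) → Fin (n G) → Set where
  here : ∀ {x} → Reach G P x x
  fwd  : ∀ {y} e → P e → Reach G P (tgt G e) y → Reach G P (src G e) y
  bwd  : ∀ {y} e → P e → Reach G P (src G e) y → Reach G P (tgt G e) y

Connected : Graph → Set
Connected G = ∀ x y → Reach G (λ _ → ⊤) x y

Bridge : (G : Graph) → Fin (m G) → Set
Bridge G e = ¬ (∀ x y → Reach G (λ e' → e' ≢ e) x y)

Divisor : Graph → Set
Divisor G = Fin (n G) → ℤ

sumFin : ∀ {k} → (Fin k → ℤ) → ℤ
sumFin {zero}  f = 0ℤ
sumFin {suc k} f = f zero + sumFin (λ i → f (suc i))

when≡ : ∀ {k} → Fin k → Fin k → ℤ → ℤ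
when≡ x y z with x ≟ y
... | yes _ = z
... | no _  = 0ℤ

div : (G : Graph) → (Fin (n G) → ℤ) → Divisor G
div G f x = sumFin λ e →
  when≡ x (src G e) (f (src G e) - f (tgt G e))
  + when≡ x (tgt G e) (f (tgt G e) - f (src G e))

Principal : (G : Graph) → Divisor G → Set
Principal G D = ∃[ f ] (∀ x → D x ≡ div G f x)

push : (G H : Graph) → (Fin (n G) → Fin (n H)) → Divisor G → Divisor H
push G H ρ D y = sumFin λ x → when≡ (ρ x) y (D x)

record IsBridgeContraction (G H : Graph) (ρ : Fin (n G) → Fin (n H))
                           (ψ : Fin (m H) → Fin (m G)) : Set where
  field
    ρ-surj   : ∀ y → ∃[ x ] ρ x ≡ y
    ρ-ident  : ∀ x x' → (ρ x ≡ ρ x') ⇔ Reach G (Bridge G) x x'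
    ψ-inj    : ∀ e e' → ψ e ≡ ψ e' → e ≡ e'
    ψ-image  : ∀ e → (¬ Bridge G e) ⇔ (∃[ e' ] ψ e' ≡ e)
    ψ-src    : ∀ e → src H e ≡ ρ (src G (ψ e))
    ψ-tgt    : ∀ e → tgt H e ≡ ρ (tgt G (ψ e))

module Submission where

-- Write d f e = f(src e) - f(tgt e) for the change of a vertex
-- function along an edge and ∂ c for the boundary of an edge chain c, so that
-- div f = ∂ (d f).  Two facts drive the proof.
--  * A bridge has both endpoints in one fibre of ρ, so ρ_* (∂_G c) = ∂_H (c ∘ ψ);
--    hence ρ_* (div_G f) = ∂_H (d f ∘ ψ) and div_H g = ρ_* (div_G (g ∘ ρ)).
--  * In a connected graph, a bridge b has a cut function (the indicator of the
--    side of b containing src b), changing by 1 along b and 0 along other edges.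
-- (⇒) Subtracting the cut functions, weighted by d f, from f kills its change on
-- bridges only; the result is constant on fibres, i.e. g ∘ ρ, and
-- ρ_*(div f) = ∂_H (d f ∘ ψ) = div_H g.  (⇐) If ρ_* D = div_H g, then
-- E = D - div_G (g ∘ ρ) has ρ_* E = 0; moving the chips of E to a chosen vertex of
-- each fibre is principal (cut functions again) and gives 0, so E and D are principal.

open import Defs
open import Data.Nat as ℕ using (ℕ; zero; suc)
import Data.Nat.Properties as ℕ
open import Data.Fin using (Fin; zero; suc; punchIn)
open import Data.Fin.Properties using (_≟_; any?; punchInᵢ≢i)
open import Data.Fin.Subset using (Subset; _∈_; _∉_; _∪_; ⁅_⁆; ∣_∣)
open import Data.Fin.Subset.Properties
  using (_∈?_; x∈⁅x⁆; x∈⁅y⁆⇒x≡y; p⊆p∪q; q⊆p∪q; x∈p∪q⁻; p⊂q⇒∣p∣<∣q∣; ∣p∣≤n)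
open import Data.Integer using (ℤ; _+_; _-_; _*_; -_; 0ℤ; 1ℤ; -1ℤ)
open import Data.Integer.Properties
  using ( +-*-semiring; +-identityʳ; +-inverseʳ; *-identityˡ; *-identityʳ; *-zeroˡ; *-zeroʳ
        ; -1*i≡-i; i-j≡0⇒i≡j)
open import Data.Integer.Tactic.RingSolver using (solve-∀)
open import Algebra.Properties.Semiring.Sum +-*-semiring
  using ( sum; sum-cong-≗; sum-replicate-zero; sum-remove; ∑-distrib-+; ∑-comm
        ; *-distribˡ-sum)
open import Data.Product using (_×_; _,_; proj₁; proj₂; Σ; ∃-syntax)
open import Data.Sum using (_⊎_; inj₁; inj₂)
open import Data.Unit using (⊤)
open import Function using (_∘_)
open import Function.Bundles using (_⇔_; mk⇔; Equivalence)
open import Relation.Nullary using (¬_; Dec; yes; no; contradiction)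
open import Relation.Nullary.Decidable using (_×-dec_; _⊎-dec_; ¬?)
open import Relation.Binary.PropositionalEquality
  using (_≡_; _≢_; refl; sym; trans; cong; cong₂; module ≡-Reasoning)

sumFin≡sum : ∀ {k} (f : Fin k → ℤ) → sumFin f ≡ sum f
sumFin≡sum {zero}  f = refl
sumFin≡sum {suc k} f = cong (f zero +_) (sumFin≡sum (λ i → f (suc i)))

∑-zero : ∀ {k} {f : Fin k → ℤ} → (∀ i → f i ≡ 0ℤ) → sum f ≡ 0ℤ
∑-zero {k} f≗0 = trans (sum-cong-≗ f≗0) (sum-replicate-zero k)

∑-single : ∀ {k} {f : Fin k → ℤ} (i : Fin k) → (∀ j → j ≢ i → f j ≡ 0ℤ) → sum f ≡ f i
∑-single {suc k} {f} i others = begin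
  sum f                                     ≡⟨ sum-remove f ⟩
  f i + sum (λ j → f (punchIn i j))         ≡⟨ cong (f i +_) (∑-zero (λ j → others _ (punchInᵢ≢i i j))) ⟩
  f i + 0ℤ                                  ≡⟨ +-identityʳ (f i) ⟩
  f i                                       ∎
  where open ≡-Reasoning

∑-neg : ∀ {k} (f : Fin k → ℤ) → sum (λ i → - f i) ≡ - sum f
∑-neg f = begin
  sum (λ i → - f i)        ≡⟨ sum-cong-≗ (λ i → sym (-1*i≡-i (f i))) ⟩
  sum (λ i → -1ℤ * f i)    ≡⟨ *-distribˡ-sum -1ℤ f ⟨
  -1ℤ * sum f              ≡⟨ -1*i≡-i (sum f) ⟩
  - sum f                  ∎
  where open ≡-Reasoning

∑-sub : ∀ {k} (f g : Fin k → ℤ) → sum (λ i → f i - g i) ≡ sum f - sum g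
∑-sub f g = trans (∑-distrib-+ f (λ i → - g i)) (cong (sum f +_) (∑-neg g))

δ : ∀ {k} → Fin k → Fin k → ℤ
δ x y = when≡ x y 1ℤ

when≡-δ : ∀ {k} (x y : Fin k) z → when≡ x y z ≡ δ x y * z
when≡-δ x y z with x ≟ y
... | yes _ = sym (*-identityˡ z)
... | no _  = sym (*-zeroˡ z)

δ-refl : ∀ {k} (x : Fin k) → δ x x ≡ 1ℤ
δ-refl x with x ≟ x
... | yes _   = refl
... | no x≢x = contradiction refl x≢x

δ-≢ : ∀ {k} {x y : Fin k} → x ≢ y → δ x y ≡ 0ℤ
δ-≢ {x = x} {y} x≢y with x ≟ y
... | yes x≡y = contradiction x≡y x≢y
... | no _    = refl

δ-sym : ∀ {k} (x y : Fin k) → δ x y ≡ δ y x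
δ-sym x y with x ≟ y | y ≟ x
... | yes _   | yes _   = refl
... | no _    | no _    = refl
... | yes x≡y | no y≢x = contradiction (sym x≡y) y≢x
... | no x≢y  | yes y≡x = contradiction (sym y≡x) x≢y

∑-δ : ∀ {k} (u : Fin k) (f : Fin k → ℤ) → sum (λ x → δ u x * f x) ≡ f u
∑-δ u f = trans (∑-single u off) (trans (cong (_* f u) (δ-refl u)) (*-identityˡ (f u)))
  where
  off : ∀ x → x ≢ u → δ u x * f x ≡ 0ℤ
  off x x≢u = trans (cong (_* f x) (δ-≢ (x≢u ∘ sym))) (*-zeroˡ (f x))

∑-reindex : ∀ {k l} (ψ : Fin k → Fin l) → (∀ i j → ψ i ≡ ψ j → i ≡ j) →
            (h : Fin l → ℤ) → (∀ e → ¬ (∃[ i ] ψ i ≡ e) → h e ≡ 0ℤ) →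
            sum h ≡ sum (λ i → h (ψ i))
∑-reindex ψ ψ-inj h h-off = sym (begin
  sum (λ i → h (ψ i))                         ≡⟨ sum-cong-≗ (λ i → sym (∑-δ (ψ i) h)) ⟩
  sum (λ i → sum (λ e → δ (ψ i) e * h e))     ≡⟨ ∑-comm (λ i e → δ (ψ i) e * h e) ⟩
  sum (λ e → sum (λ i → δ (ψ i) e * h e))     ≡⟨ sum-cong-≗ fibre ⟩
  sum h                                       ∎)
  where
  open ≡-Reasoning
  -- Each e is hit by at most one i; if by none, h e = 0.
  fibre : ∀ e → sum (λ i → δ (ψ i) e * h e) ≡ h e
  fibre e with any? (λ i → ψ i ≟ e)
  ... | yes (i , ψi≡e) = trans (∑-single i others) (trans (cong (_* h e) hit) (*-identityˡ (h e)))
    where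
    hit : δ (ψ i) e ≡ 1ℤ
    hit = trans (cong (λ v → δ v e) ψi≡e) (δ-refl e)
    others : ∀ j → j ≢ i → δ (ψ j) e * h e ≡ 0ℤ
    others j j≢i = trans (cong (_* h e) (δ-≢ (λ ψj≡e → j≢i (ψ-inj j i (trans ψj≡e (sym ψi≡e))))))
                         (*-zeroˡ (h e))
  ... | no outside = trans (∑-zero missed) (sym (h-off e outside))
    where
    missed : ∀ i → δ (ψ i) e * h e ≡ 0ℤ
    missed i = trans (cong (_* h e) (δ-≢ (λ ψi≡e → outside (i , ψi≡e)))) (*-zeroˡ (h e))

module _ {G : Graph} {P : Fin (m G) → Set} where

  reach-trans : ∀ {x y z} → Reach G P x y → Reach G P y z → Reach G P x z
  reach-trans here        r′ = r′
  reach-trans (fwd e p r) r′ = fwd e p (reach-trans r r′)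
  reach-trans (bwd e p r) r′ = bwd e p (reach-trans r r′)

  reach-sym : ∀ {x y} → Reach G P x y → Reach G P y x
  reach-sym here        = here
  reach-sym (fwd e p r) = reach-trans (reach-sym r) (bwd e p here)
  reach-sym (bwd e p r) = reach-trans (reach-sym r) (fwd e p here)

-- In a connected graph, the endpoints of a bridge b are not joined by a path
-- avoiding b: such a path could replace b in every walk.
bridge-separates : ∀ {G} → Connected G → ∀ {b} → Bridge G b →
                   ¬ Reach G (_≢ b) (src G b) (tgt G b)
bridge-separates {G} conn {b} bridge across = bridge (λ x y → avoid (conn x y))
  where
  avoid : ∀ {x y} → Reach G (λ _ → ⊤) x y → Reach G (_≢ b) x y
  avoid here = here
  avoid (fwd e _ r) with e ≟ b
  ... | yes refl = reach-trans across (avoid r)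
  ... | no e≢b   = fwd e e≢b (avoid r)
  avoid (bwd e _ r) with e ≟ b
  ... | yes refl = reach-trans (reach-sym across) (avoid r)
  ... | no e≢b   = bwd e e≢b (avoid r)

record Component (G : Graph) (P : Fin (m G) → Set) (x0 : Fin (n G)) : Set where
  field
    set        : Subset (n G)
    seed       : x0 ∈ set
    sound      : ∀ {x} → x ∈ set → Reach G P x0 x
    closed-fwd : ∀ {e} → P e → src G e ∈ set → tgt G e ∈ set
    closed-bwd : ∀ {e} → P e → tgt G e ∈ set → src G e ∈ set

-- Components of a decidable subgraph are computed by exploration: starting
-- from {x0}, repeatedly add the far endpoint of a P-edge leaving the set.
-- Each step enlarges the set, so at most n G steps are needed.
module Exploration (G : Graph) {P : Fin (m G) → Set} (P? : ∀ e → Dec (P e))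
                   (x0 : Fin (n G)) where

  Leaving : Subset (n G) → Fin (m G) → Set
  Leaving S e = P e × ((src G e ∈ S × tgt G e ∉ S) ⊎ (tgt G e ∈ S × src G e ∉ S))

  leaving? : ∀ S e → Dec (Leaving S e)
  leaving? S e = P? e ×-dec ((src G e ∈? S ×-dec ¬? (tgt G e ∈? S))
                            ⊎-dec (tgt G e ∈? S ×-dec ¬? (src G e ∈? S)))

  record Explored (S : Subset (n G)) : Set where
    field
      seed  : x0 ∈ S
      sound : ∀ {x} → x ∈ S → Reach G P x0 x

  new-vertex : ∀ {S e} → Explored S → Leaving S e → ∃[ w ] (w ∉ S × Reach G P x0 w)
  new-vertex {e = e} ex (p , inj₁ (s∈S , t∉S)) =
    tgt G e , t∉S , reach-trans (Explored.sound ex s∈S) (fwd e p here)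
  new-vertex {e = e} ex (p , inj₂ (t∈S , s∉S)) =
    src G e , s∉S , reach-trans (Explored.sound ex t∈S) (bwd e p here)

  extend : ∀ {S w} → Explored S → Reach G P x0 w → Explored (S ∪ ⁅ w ⁆)
  extend {S} {w} ex x0↝w = record
    { seed  = p⊆p∪q ⁅ w ⁆ (Explored.seed ex)
    ; sound = λ x∈ → sound′ (x∈p∪q⁻ S ⁅ w ⁆ x∈)
    }
    where
    sound′ : ∀ {x} → x ∈ S ⊎ x ∈ ⁅ w ⁆ → Reach G P x0 x
    sound′ (inj₁ x∈S) = Explored.sound ex x∈S
    sound′ (inj₂ x∈w) with x∈⁅y⁆⇒x≡y w x∈w
    ... | refl = x0↝w

  grows : ∀ {S : Subset (n G)} {w} → w ∉ S → ∣ S ∣ ℕ.< ∣ S ∪ ⁅ w ⁆ ∣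
  grows {S} {w} w∉S = p⊂q⇒∣p∣<∣q∣ (p⊆p∪q ⁅ w ⁆ , w , q⊆p∪q S ⁅ w ⁆ (x∈⁅x⁆ w) , w∉S)

  -- The fuel bound n G ≤ fuel + ∣ S ∣ guarantees that S is full when fuel runs
  -- out, so that no vertex outside S can be found then.
  explore : (fuel : ℕ) (S : Subset (n G)) → Explored S → n G ℕ.≤ fuel ℕ.+ ∣ S ∣ →
            Component G P x0
  explore fuel S ex bound with any? (leaving? S)
  ... | no none = record
    { set = S ; seed = Explored.seed ex ; sound = Explored.sound ex
    ; closed-fwd = λ {e} p s∈S → closed (λ t∉S → none (e , p , inj₁ (s∈S , t∉S)))
    ; closed-bwd = λ {e} p t∈S → closed (λ s∉S → none (e , p , inj₂ (t∈S , s∉S)))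
    }
    where
    closed : ∀ {x} → ¬ ¬ (x ∈ S) → x ∈ S
    closed {x} ¬x∉S with x ∈? S
    ... | yes x∈S = x∈S
    ... | no x∉S  = contradiction x∉S ¬x∉S
  ... | yes (e , leaves) with new-vertex ex leaves
  ...   | w , w∉S , x0↝w with fuel
  ...     | zero = contradiction bound
                                 (ℕ.<⇒≱ (ℕ.<-≤-trans (grows w∉S) (∣p∣≤n (S ∪ ⁅ w ⁆))))
  ...     | suc fuel′ = explore fuel′ (S ∪ ⁅ w ⁆) (extend ex x0↝w)
                          (ℕ.≤-trans bound (ℕ.≤-trans (ℕ.≤-reflexive (sym (ℕ.+-suc fuel′ ∣ S ∣)))
                                                      (ℕ.+-monoʳ-≤ fuel′ (grows w∉S))))

  component : Component G P x0
  component = explore (n G) ⁅ x0 ⁆ start (ℕ.m≤m+n (n G) ∣ ⁅ x0 ⁆ ∣)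
    where
    start : Explored ⁅ x0 ⁆
    start = record { seed = x∈⁅x⁆ x0 ; sound = λ x∈ → reach-from (x∈⁅y⁆⇒x≡y x0 x∈) }
      where
      reach-from : ∀ {x} → x ≡ x0 → Reach G P x0 x
      reach-from refl = here

d : (G : Graph) → (Fin (n G) → ℤ) → Fin (m G) → ℤ
d G f e = f (src G e) - f (tgt G e)

-- For a bridge b of a connected graph, the indicator of the side of b
-- containing src b changes by 1 along b and by 0 along every other edge.
cut-function : ∀ {G} → Connected G → ∀ {b} → Bridge G b →
               Σ (Fin (n G) → ℤ) λ χ → d G χ b ≡ 1ℤ × (∀ e → e ≢ b → d G χ e ≡ 0ℤ)
cut-function {G} conn {b} bridge = χ , across , along
  where
  open Component (Exploration.component G (λ e → ¬? (e ≟ b)) (src G b))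

  indicator : ∀ {x} → Dec (x ∈ set) → ℤ
  indicator (yes _) = 1ℤ
  indicator (no _)  = 0ℤ

  χ : Fin (n G) → ℤ
  χ x = indicator (x ∈? set)

  across : d G χ b ≡ 1ℤ
  across with src G b ∈? set | tgt G b ∈? set
  ... | yes _ | no _    = refl
  ... | no s∉ | _       = contradiction seed s∉
  ... | yes _ | yes t∈ = contradiction (sound t∈) (bridge-separates conn bridge)

  along : ∀ e → e ≢ b → d G χ e ≡ 0ℤ
  along e e≢b with src G e ∈? set | tgt G e ∈? set
  ... | yes _  | yes _  = refl
  ... | no _   | no _   = refl
  ... | yes s∈ | no t∉ = contradiction (closed-fwd e≢b s∈) t∉
  ... | no s∉  | yes t∈ = contradiction (closed-bwd e≢b t∈) s∉

incidence : (G : Graph) → Fin (m G) → Fin (n G) → ℤ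
incidence G e x = δ (src G e) x - δ (tgt G e) x

∂ : (G : Graph) → (Fin (m G) → ℤ) → Divisor G
∂ G c x = sum λ e → incidence G e x * c e

div≡∂d : ∀ G f x → div G f x ≡ ∂ G (d G f) x
div≡∂d G f x = trans (sumFin≡sum term) (sum-cong-≗ edge)
  where
  open ≡-Reasoning
  term : Fin (m G) → ℤ
  term e = when≡ x (src G e) (d G f e) + when≡ x (tgt G e) (f (tgt G e) - f (src G e))
  regroup : ∀ a b p q → a * (p - q) + b * (q - p) ≡ (a - b) * (p - q)
  regroup = solve-∀
  edge : ∀ e → term e ≡ incidence G e x * d G f e
  edge e = begin
    when≡ x s (fs - ft) + when≡ x t (ft - fs) ≡⟨ cong₂ _+_ (when≡-δ x s _) (when≡-δ x t _) ⟩
    δ x s * (fs - ft) + δ x t * (ft - fs)     ≡⟨ cong₂ (λ a b → a * (fs - ft) + b * (ft - fs))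
                                                       (δ-sym x s) (δ-sym x t) ⟩
    δ s x * (fs - ft) + δ t x * (ft - fs)     ≡⟨ regroup (δ s x) (δ t x) fs ft ⟩
    (δ s x - δ t x) * (fs - ft)               ∎
    where
    s t : Fin (n G)
    s = src G e
    t = tgt G e
    fs ft : ℤ
    fs = f s
    ft = f t

∂-cong : ∀ G {c c′} → (∀ e → c e ≡ c′ e) → ∀ x → ∂ G c x ≡ ∂ G c′ x
∂-cong G c≗c′ x = sum-cong-≗ (λ e → cong (incidence G e x *_) (c≗c′ e))

div-+ : ∀ G f f′ x → div G (λ z → f z + f′ z) x ≡ div G f x + div G f′ x
div-+ G f f′ x = begin
  div G (λ z → f z + f′ z) x                     ≡⟨ div≡∂d G (λ z → f z + f′ z) x ⟩
  ∂ G (d G (λ z → f z + f′ z)) x                 ≡⟨ sum-cong-≗ split ⟩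
  sum (λ e → ∂f e + ∂f′ e)                       ≡⟨ ∑-distrib-+ ∂f ∂f′ ⟩
  ∂ G (d G f) x + ∂ G (d G f′) x                 ≡⟨ cong₂ _+_ (div≡∂d G f x) (div≡∂d G f′ x) ⟨
  div G f x + div G f′ x                         ∎
  where
  open ≡-Reasoning
  ∂f ∂f′ : Fin (m G) → ℤ
  ∂f e = incidence G e x * d G f e
  ∂f′ e = incidence G e x * d G f′ e
  expand : ∀ a p q p′ q′ → a * ((p + p′) - (q + q′)) ≡ a * (p - q) + a * (p′ - q′)
  expand = solve-∀
  split : ∀ e → incidence G e x * d G (λ z → f z + f′ z) e ≡ ∂f e + ∂f′ e
  split e = expand (incidence G e x) (f (src G e)) (f (tgt G e)) (f′ (src G e)) (f′ (tgt G e))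

div-scale : ∀ G k f x → div G (λ z → k * f z) x ≡ k * div G f x
div-scale G k f x = begin
  div G (λ z → k * f z) x                 ≡⟨ div≡∂d G (λ z → k * f z) x ⟩
  ∂ G (d G (λ z → k * f z)) x             ≡⟨ sum-cong-≗ pull-out ⟩
  sum (λ e → k * ∂f e)                    ≡⟨ *-distribˡ-sum k ∂f ⟨
  k * ∂ G (d G f) x                       ≡⟨ cong (k *_) (div≡∂d G f x) ⟨
  k * div G f x                           ∎
  where
  open ≡-Reasoning
  ∂f : Fin (m G) → ℤ
  ∂f e = incidence G e x * d G f e
  expand : ∀ a k p q → a * (k * p - k * q) ≡ k * (a * (p - q))
  expand = solve-∀
  pull-out : ∀ e → incidence G e x * d G (λ z → k * f z) e ≡ k * ∂f e
  pull-out e = expand (incidence G e x) k (f (src G e)) (f (tgt G e))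

principal-cong : ∀ G {D D′ : Divisor G} → (∀ x → D x ≡ D′ x) → Principal G D → Principal G D′
principal-cong G D≗D′ (f , D≡div) = f , λ x → trans (sym (D≗D′ x)) (D≡div x)

principal-zero : ∀ G → Principal G (λ _ → 0ℤ)
principal-zero G = (λ _ → 0ℤ) , λ x →
  sym (trans (div≡∂d G (λ _ → 0ℤ) x) (∑-zero (λ e → *-zeroʳ (incidence G e x))))

principal-+ : ∀ G {D D′ : Divisor G} → Principal G D → Principal G D′ →
              Principal G (λ x → D x + D′ x)
principal-+ G (f , D≡) (f′ , D′≡) =
  (λ z → f z + f′ z) , λ x → trans (cong₂ _+_ (D≡ x) (D′≡ x)) (sym (div-+ G f f′ x))

principal-scale : ∀ G {D : Divisor G} k → Principal G D → Principal G (λ x → k * D x)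
principal-scale G k (f , D≡) = (λ z → k * f z) , λ x → trans (cong (k *_) (D≡ x)) (sym (div-scale G k f x))

principal-∑ : ∀ G {k} (Ds : Fin k → Divisor G) → (∀ i → Principal G (Ds i)) →
              Principal G (λ x → sum (λ i → Ds i x))
principal-∑ G {zero}  Ds _    = principal-zero G
principal-∑ G {suc k} Ds each = principal-+ G (each zero) (principal-∑ G (Ds ∘ suc) (each ∘ suc))

bridge-principal : ∀ {G} → Connected G → ∀ {b} → Bridge G b →
                   Principal G (λ z → δ (src G b) z - δ (tgt G b) z)
bridge-principal {G} conn {b} bridge = χ , λ z → sym (div-χ z)
  where
  open ≡-Reasoning
  χ : Fin (n G) → ℤ
  χ = proj₁ (cut-function conn bridge)
  across : d G χ b ≡ 1ℤ
  across = proj₁ (proj₂ (cut-function conn bridge))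
  along : ∀ e → e ≢ b → d G χ e ≡ 0ℤ
  along = proj₂ (proj₂ (cut-function conn bridge))
  div-χ : ∀ z → div G χ z ≡ δ (src G b) z - δ (tgt G b) z
  div-χ z = begin
    div G χ z                     ≡⟨ div≡∂d G χ z ⟩
    ∂ G (d G χ) z                 ≡⟨ ∑-single b (λ e e≢b → trans (cong (incidence G e z *_) (along e e≢b))
                                                                 (*-zeroʳ (incidence G e z))) ⟩
    incidence G b z * d G χ b     ≡⟨ cong (incidence G b z *_) across ⟩
    incidence G b z * 1ℤ          ≡⟨ *-identityʳ (incidence G b z) ⟩
    incidence G b z               ∎

bridge-path-principal : ∀ {G} → Connected G → ∀ {u w} → Reach G (Bridge G) u w →
                        Principal G (λ z → δ u z - δ w z)
bridge-path-principal {G} conn {u} here =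
  principal-cong G (λ z → sym (+-inverseʳ (δ u z))) (principal-zero G)
bridge-path-principal {G} conn {w = w} (fwd e bridge r) =
  principal-cong G (λ z → telescope (δ (src G e) z) (δ (tgt G e) z) (δ w z))
    (principal-+ G (bridge-principal conn bridge) (bridge-path-principal conn r))
  where
  telescope : ∀ a b c → (a - b) + (b - c) ≡ a - c
  telescope = solve-∀
bridge-path-principal {G} conn {w = w} (bwd e bridge r) =
  principal-cong G (λ z → reverse (δ (src G e) z) (δ (tgt G e) z) (δ w z))
    (principal-+ G (principal-scale G -1ℤ (bridge-principal conn bridge)) (bridge-path-principal conn r))
  where
  reverse : ∀ a b c → -1ℤ * (a - b) + (a - c) ≡ b - c
  reverse = solve-∀

pushV : ∀ {k l} → (Fin k → Fin l) → (Fin k → ℤ) → Fin l → ℤ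
pushV ρ D y = sum λ x → δ (ρ x) y * D x

push≡pushV : ∀ G H ρ D y → push G H ρ D y ≡ pushV ρ D y
push≡pushV G H ρ D y = trans (sumFin≡sum (λ x → when≡ (ρ x) y (D x)))
                             (sum-cong-≗ (λ x → when≡-δ (ρ x) y (D x)))

pushV-sub : ∀ {k l} (ρ : Fin k → Fin l) D D′ y →
            pushV ρ (λ x → D x - D′ x) y ≡ pushV ρ D y - pushV ρ D′ y
pushV-sub ρ D D′ y = trans (sum-cong-≗ (λ x → distrib (δ (ρ x) y) (D x) (D′ x)))
                           (∑-sub (λ x → δ (ρ x) y * D x) (λ x → δ (ρ x) y * D′ x))
  where
  distrib : ∀ a p q → a * (p - q) ≡ a * p - a * q
  distrib = solve-∀

pushV-zero : ∀ {k l} (ρ : Fin k → Fin l) {D} → (∀ x → D x ≡ 0ℤ) → ∀ y → pushV ρ D y ≡ 0ℤ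
pushV-zero ρ D≗0 y = ∑-zero (λ x → trans (cong (δ (ρ x) y *_) (D≗0 x)) (*-zeroʳ (δ (ρ x) y)))

pushV-∘ : ∀ {k l p} (σ : Fin l → Fin p) (ρ : Fin k → Fin l) D z →
          pushV σ (pushV ρ D) z ≡ pushV (σ ∘ ρ) D z
pushV-∘ σ ρ D z = begin
  sum (λ y → δ (σ y) z * sum (λ x → δ (ρ x) y * D x))
    ≡⟨ sum-cong-≗ (λ y → *-distribˡ-sum (δ (σ y) z) (λ x → δ (ρ x) y * D x)) ⟩
  sum (λ y → sum (λ x → δ (σ y) z * (δ (ρ x) y * D x)))
    ≡⟨ ∑-comm (λ y x → δ (σ y) z * (δ (ρ x) y * D x)) ⟩
  sum (λ x → sum (λ y → δ (σ y) z * (δ (ρ x) y * D x)))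
    ≡⟨ sum-cong-≗ (λ x → sum-cong-≗ (λ y → swap (δ (σ y) z) (δ (ρ x) y) (D x))) ⟩
  sum (λ x → sum (λ y → δ (ρ x) y * (δ (σ y) z * D x)))
    ≡⟨ sum-cong-≗ (λ x → ∑-δ (ρ x) (λ y → δ (σ y) z * D x)) ⟩
  sum (λ x → δ (σ (ρ x)) z * D x) ∎
  where
  open ≡-Reasoning
  swap : ∀ a b c → a * (b * c) ≡ b * (a * c)
  swap = solve-∀

pushV-∂ : ∀ G {l} (ρ : Fin (n G) → Fin l) c y →
          pushV ρ (∂ G c) y ≡ sum (λ e → (δ (ρ (src G e)) y - δ (ρ (tgt G e)) y) * c e)
pushV-∂ G ρ c y = begin
  sum (λ x → δ (ρ x) y * sum (λ e → incidence G e x * c e))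
    ≡⟨ sum-cong-≗ (λ x → *-distribˡ-sum (δ (ρ x) y) (λ e → incidence G e x * c e)) ⟩
  sum (λ x → sum (λ e → δ (ρ x) y * (incidence G e x * c e)))
    ≡⟨ ∑-comm (λ x e → δ (ρ x) y * (incidence G e x * c e)) ⟩
  sum (λ e → sum (λ x → δ (ρ x) y * (incidence G e x * c e)))
    ≡⟨ sum-cong-≗ edge ⟩
  sum (λ e → (δ (ρ (src G e)) y - δ (ρ (tgt G e)) y) * c e) ∎
  where
  open ≡-Reasoning
  spread : ∀ r s t a → r * ((s - t) * a) ≡ s * (r * a) - t * (r * a)
  spread = solve-∀
  gather : ∀ p q a → p * a - q * a ≡ (p - q) * a
  gather = solve-∀
  edge : ∀ e → sum (λ x → δ (ρ x) y * (incidence G e x * c e))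
               ≡ (δ (ρ (src G e)) y - δ (ρ (tgt G e)) y) * c e
  edge e = begin
    sum (λ x → δ (ρ x) y * (incidence G e x * c e))
      ≡⟨ sum-cong-≗ (λ x → spread (δ (ρ x) y) (δ s x) (δ t x) (c e)) ⟩
    sum (λ x → δ s x * chips x - δ t x * chips x)
      ≡⟨ ∑-sub (λ x → δ s x * chips x) (λ x → δ t x * chips x) ⟩
    sum (λ x → δ s x * chips x) - sum (λ x → δ t x * chips x)
      ≡⟨ cong₂ _-_ (∑-δ s chips) (∑-δ t chips) ⟩
    δ (ρ s) y * c e - δ (ρ t) y * c e
      ≡⟨ gather (δ (ρ s) y) (δ (ρ t) y) (c e) ⟩
    (δ (ρ s) y - δ (ρ t) y) * c e ∎
    where
    s t : Fin (n G)
    s = src G e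
    t = tgt G e
    chips : Fin (n G) → ℤ
    chips x = δ (ρ x) y * c e

move-principal : ∀ G (r : Fin (n G) → Fin (n G)) →
                 (∀ x → Principal G (λ z → δ x z - δ (r x) z)) →
                 (E : Divisor G) → Principal G (λ z → E z - pushV r E z)
move-principal G r move E =
  principal-cong G decompose
    (principal-∑ G (λ x z → E x * (δ x z - δ (r x) z)) (λ x → principal-scale G (E x) (move x)))
  where
  open ≡-Reasoning
  distrib : ∀ e a b → e * (a - b) ≡ a * e - b * e
  distrib = solve-∀
  per-vertex : ∀ z x → E x * (δ x z - δ (r x) z) ≡ δ z x * E x - δ (r x) z * E x
  per-vertex z x = trans (cong (λ a → E x * (a - δ (r x) z)) (δ-sym x z))
                         (distrib (E x) (δ z x) (δ (r x) z))
  decompose : ∀ z → sum (λ x → E x * (δ x z - δ (r x) z)) ≡ E z - pushV r E z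
  decompose z = begin
    sum (λ x → E x * (δ x z - δ (r x) z))         ≡⟨ sum-cong-≗ (per-vertex z) ⟩
    sum (λ x → δ z x * E x - δ (r x) z * E x)     ≡⟨ ∑-sub (λ x → δ z x * E x) (λ x → δ (r x) z * E x) ⟩
    sum (λ x → δ z x * E x) - pushV r E z         ≡⟨ cong (_- pushV r E z) (∑-δ z E) ⟩
    E z - pushV r E z                             ∎

module Contraction {G H : Graph} (conn : Connected G)
                   {ρ : Fin (n G) → Fin (n H)} {ψ : Fin (m H) → Fin (m G)}
                   (C : IsBridgeContraction G H ρ ψ) where
  open IsBridgeContraction C
  open ≡-Reasoning

  outside-image-bridge : ∀ {e} → ¬ (∃[ e′ ] ψ e′ ≡ e) → Bridge G e
  outside-image-bridge {e} outside connected =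
    outside (Equivalence.to (ψ-image e) (λ bridge → bridge connected))

  bridge? : ∀ e → Dec (Bridge G e)
  bridge? e with any? (λ e′ → ψ e′ ≟ e)
  ... | yes inside = no (Equivalence.from (ψ-image e) inside)
  ... | no outside = yes (outside-image-bridge outside)

  bridge-collapses : ∀ {e} → Bridge G e → ρ (src G e) ≡ ρ (tgt G e)
  bridge-collapses {e} bridge = Equivalence.from (ρ-ident (src G e) (tgt G e)) (fwd e bridge here)

  -- Pushing a boundary forward only sees the non-bridge edges, i.e. the edges
  -- of H: the contribution of a bridge cancels.
  push-∂ : ∀ c y → pushV ρ (∂ G c) y ≡ ∂ H (c ∘ ψ) y
  push-∂ c y = begin
    pushV ρ (∂ G c) y
      ≡⟨ pushV-∂ G ρ c y ⟩
    sum (λ e → moved e * c e)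
      ≡⟨ ∑-reindex ψ ψ-inj (λ e → moved e * c e) cancels ⟩
    sum (λ e′ → moved (ψ e′) * c (ψ e′))
      ≡⟨ sum-cong-≗ (λ e′ → cong₂ (λ a b → (δ a y - δ b y) * c (ψ e′)) (sym (ψ-src e′)) (sym (ψ-tgt e′))) ⟩
    ∂ H (c ∘ ψ) y ∎
    where
    moved : Fin (m G) → ℤ
    moved e = δ (ρ (src G e)) y - δ (ρ (tgt G e)) y
    cancels : ∀ e → ¬ (∃[ e′ ] ψ e′ ≡ e) → moved e * c e ≡ 0ℤ
    cancels e outside = begin
      moved e * c e                   ≡⟨ cong (λ v → (δ v y - δ (ρ (tgt G e)) y) * c e)
                                              (bridge-collapses (outside-image-bridge outside)) ⟩
      (δ t y - δ t y) * c e           ≡⟨ cong (_* c e) (+-inverseʳ (δ t y)) ⟩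
      0ℤ * c e                        ≡⟨ *-zeroˡ (c e) ⟩
      0ℤ                              ∎
      where
      t : Fin (n H)
      t = ρ (tgt G e)

  push-div : ∀ f y → pushV ρ (div G f) y ≡ ∂ H (d G f ∘ ψ) y
  push-div f y = trans (sum-cong-≗ (λ x → cong (δ (ρ x) y *_) (div≡∂d G f x))) (push-∂ (d G f) y)

  div-H : ∀ g y → div H g y ≡ ∂ H (d G (g ∘ ρ) ∘ ψ) y
  div-H g y = trans (div≡∂d H g y)
                    (∂-cong H (λ e′ → cong₂ (λ a b → g a - g b) (ψ-src e′) (ψ-tgt e′)) y)

  rep : Fin (n H) → Fin (n G)
  rep y = proj₁ (ρ-surj y)

  to-rep : ∀ x → Reach G (Bridge G) x (rep (ρ x))
  to-rep x = Equivalence.to (ρ-ident x (rep (ρ x))) (sym (proj₂ (ρ-surj (ρ x))))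

  factor : (f : Fin (n G) → ℤ) → (∀ e → Bridge G e → d G f e ≡ 0ℤ) → ∀ x → f (rep (ρ x)) ≡ f x
  factor f flat x = sym (constant (to-rep x))
    where
    constant : ∀ {x x′} → Reach G (Bridge G) x x′ → f x ≡ f x′
    constant here             = refl
    constant (fwd e bridge r) = trans (i-j≡0⇒i≡j _ _ (flat e bridge)) (constant r)
    constant (bwd e bridge r) = trans (sym (i-j≡0⇒i≡j _ _ (flat e bridge))) (constant r)

  cut : Fin (m G) → Fin (n G) → ℤ
  cut b with bridge? b
  ... | yes bridge = proj₁ (cut-function conn bridge)
  ... | no _       = λ _ → 0ℤ

  cut-off : ∀ b e → e ≢ b → d G (cut b) e ≡ 0ℤ
  cut-off b e e≢b with bridge? b
  ... | yes bridge = proj₂ (proj₂ (cut-function conn bridge)) e e≢b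
  ... | no _       = refl

  cut-bridge : ∀ {b} → Bridge G b → d G (cut b) b ≡ 1ℤ
  cut-bridge {b} bridge′ with bridge? b
  ... | yes bridge = proj₁ (proj₂ (cut-function conn bridge))
  ... | no ¬bridge = contradiction bridge′ ¬bridge

  cut-nonbridge : ∀ {b} → ¬ Bridge G b → d G (cut b) b ≡ 0ℤ
  cut-nonbridge {b} ¬bridge′ with bridge? b
  ... | yes bridge = contradiction bridge ¬bridge′
  ... | no _       = refl

  -- straighten f subtracts from f the cut functions weighted by the change of f,
  -- which removes the change of f along every bridge and nowhere else.
  straighten : (Fin (n G) → ℤ) → Fin (n G) → ℤ
  straighten f z = f z - sum (λ b → d G f b * cut b z)

  d-straighten : ∀ f e → d G (straighten f) e ≡ d G f e - d G f e * d G (cut e) e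
  d-straighten f e = begin
    (f s - sum (weighted s)) - (f t - sum (weighted t))
      ≡⟨ regroup (f s) (sum (weighted s)) (f t) (sum (weighted t)) ⟩
    d G f e - (sum (weighted s) - sum (weighted t))
      ≡⟨ cong (λ v → d G f e - v) (∑-sub (weighted s) (weighted t)) ⟨
    d G f e - sum (λ b → weighted s b - weighted t b)
      ≡⟨ cong (λ v → d G f e - v) (sum-cong-≗ (λ b → distrib (d G f b) (cut b s) (cut b t))) ⟩
    d G f e - sum (λ b → d G f b * d G (cut b) e)
      ≡⟨ cong (λ v → d G f e - v) (∑-single e only-e) ⟩
    d G f e - d G f e * d G (cut e) e ∎
    where
    s t : Fin (n G)
    s = src G e
    t = tgt G e
    weighted : Fin (n G) → Fin (m G) → ℤ
    weighted z b = d G f b * cut b z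
    regroup : ∀ p a q b → (p - a) - (q - b) ≡ (p - q) - (a - b)
    regroup = solve-∀
    distrib : ∀ k a b → k * a - k * b ≡ k * (a - b)
    distrib = solve-∀
    only-e : ∀ b → b ≢ e → d G f b * d G (cut b) e ≡ 0ℤ
    only-e b b≢e = trans (cong (d G f b *_) (cut-off b e (b≢e ∘ sym))) (*-zeroʳ (d G f b))

  straighten-bridge : ∀ f {e} → Bridge G e → d G (straighten f) e ≡ 0ℤ
  straighten-bridge f {e} bridge = begin
    d G (straighten f) e                 ≡⟨ d-straighten f e ⟩
    d G f e - d G f e * d G (cut e) e    ≡⟨ cong (λ v → d G f e - d G f e * v) (cut-bridge bridge) ⟩
    d G f e - d G f e * 1ℤ               ≡⟨ vanish (d G f e) ⟩
    0ℤ                                   ∎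
    where
    vanish : ∀ a → a - a * 1ℤ ≡ 0ℤ
    vanish = solve-∀

  straighten-nonbridge : ∀ f {e} → ¬ Bridge G e → d G (straighten f) e ≡ d G f e
  straighten-nonbridge f {e} ¬bridge = begin
    d G (straighten f) e                 ≡⟨ d-straighten f e ⟩
    d G f e - d G f e * d G (cut e) e    ≡⟨ cong (λ v → d G f e - d G f e * v) (cut-nonbridge ¬bridge) ⟩
    d G f e - d G f e * 0ℤ               ≡⟨ keep (d G f e) ⟩
    d G f e                              ∎
    where
    keep : ∀ a → a - a * 0ℤ ≡ a
    keep = solve-∀

  -- (⇒)  ρ_* (div f) is the divisor on H of the straightening of f.
  principal-push : ∀ D → Principal G D → Principal H (push G H ρ D)
  principal-push D (f , D≡div) = g , λ y → begin
    push G H ρ D y              ≡⟨ push≡pushV G H ρ D y ⟩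
    pushV ρ D y                 ≡⟨ sum-cong-≗ (λ x → cong (δ (ρ x) y *_) (D≡div x)) ⟩
    pushV ρ (div G f) y         ≡⟨ push-div f y ⟩
    ∂ H (d G f ∘ ψ) y           ≡⟨ ∂-cong H agree y ⟩
    ∂ H (d G (g ∘ ρ) ∘ ψ) y     ≡⟨ div-H g y ⟨
    div H g y                   ∎
    where
    g : Fin (n H) → ℤ
    g = straighten f ∘ rep
    g∘ρ : ∀ x → g (ρ x) ≡ straighten f x
    g∘ρ = factor (straighten f) (λ e → straighten-bridge f)
    agree : ∀ e′ → d G f (ψ e′) ≡ d G (g ∘ ρ) (ψ e′)
    agree e′ = trans (sym (straighten-nonbridge f (Equivalence.from (ψ-image (ψ e′)) (e′ , refl))))
                     (sym (cong₂ _-_ (g∘ρ (src G (ψ e′))) (g∘ρ (tgt G (ψ e′)))))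

  -- Every divisor killed by ρ_* is principal: moving its chips to the chosen
  -- vertex of each fibre is principal, and that is ρ_* followed by rep_*, i.e. 0.
  kernel-principal : ∀ E → (∀ y → pushV ρ E y ≡ 0ℤ) → Principal G E
  kernel-principal E ρ*E≡0 =
    principal-cong G (λ z → trans (cong (λ v → E z - v) moved) (+-identityʳ (E z)))
      (move-principal G (rep ∘ ρ) (λ x → bridge-path-principal conn (to-rep x)) E)
    where
    moved : ∀ {z} → pushV (rep ∘ ρ) E z ≡ 0ℤ
    moved {z} = trans (sym (pushV-∘ rep ρ E z)) (pushV-zero rep ρ*E≡0 z)

  -- (⇐)  If ρ_* D = div_H g, then D - div_G (g ∘ ρ) is killed by ρ_*.
  principal-pull : ∀ D → Principal H (push G H ρ D) → Principal G D
  principal-pull D (g , push≡div) =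
    principal-cong G (λ z → restore (D z) (div G (g ∘ ρ) z))
      (principal-+ G (kernel-principal E killed) (g ∘ ρ , λ _ → refl))
    where
    E : Divisor G
    E z = D z - div G (g ∘ ρ) z
    restore : ∀ a b → (a - b) + b ≡ a
    restore = solve-∀
    killed : ∀ y → pushV ρ E y ≡ 0ℤ
    killed y = begin
      pushV ρ E y
        ≡⟨ pushV-sub ρ D (div G (g ∘ ρ)) y ⟩
      pushV ρ D y - pushV ρ (div G (g ∘ ρ)) y
        ≡⟨ cong₂ _-_ (trans (sym (push≡pushV G H ρ D y)) (push≡div y))
                     (trans (push-div (g ∘ ρ) y) (sym (div-H g y))) ⟩
      div H g y - div H g y
        ≡⟨ +-inverseʳ (div H g y) ⟩
      0ℤ ∎

-- Lemma 5.7.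
lemma5p7 : (G : Graph) → Loopless G → Connected G →
           (H : Graph) (ρ : Fin (n G) → Fin (n H)) (ψ : Fin (m H) → Fin (m G)) →
           IsBridgeContraction G H ρ ψ →
           (D : Divisor G) → Principal G D ⇔ Principal H (push G H ρ D)
lemma5p7 G _ conn H ρ ψ C D = mk⇔ (principal-push D) (principal-pull D)
  where open Contraction conn C
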